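{- Let $n$ be a positive integer, $\Gamma=C_\infty\cdot\overline{K_n}$, and let $\phi$ be a reduced coloring of $\Gamma$. For each $\varepsilon\in\{0,1\}$, the sequence $m\mapsto$ (common $\phi$-color of block $V_{2m+\varepsilon}$), $m\in\mathbb Z$, is, up to renaming colors and shifting indices, periodic with one of the periods $S_{11}(k)$, $S_{12}(k)$, $S_{22}(k)$ (mirror) or $S(k)$ (cyclic) for some positive integer $k$. That is, the admissible reduced semicolorings of $\Gamma$ are exhausted by three series of mirror and one series of cyclic semicolorings.
   Context: $\Gamma$ has vertices $v_{ij}$, $i\in\mathbb Z$, $1\le j\le n$, with $v_{ij}\sim v_{i'j'}$ iff $|i-i'|=1$; block $V_i=\{v_{i1},\dots,v_{in}\}$. $\Gamma$ is bipartite with parts $\bigcup_m V_{2m}$ and $\bigcup_m V_{2m+1}$; the coloring of one part is a semicoloring. A coloring with finitely many colors is perfect if every vertex of color $a$ has exactly $m_{ab}$ neighbours of color $b$ for a fixed matrix $(m_{ab})$. For a perfect coloring $\psi$ of $\Gamma$, two colors are equivalent if identifying them yields a perfect coloring (an equivalence relation); the coloring obtained by identifying colors within each class is a reduced coloring, which is block-monochrome (constant on each block). Periods: $[c_0\dots c_{L-1}]$ means index $m$ gets $c_{m\bmod L}$; $S_{11}(k)=[k{ - }1\;\dots\;1\;0\;1\;\dots\;k{ - }2]$, $S_{12}(k)=[k{ - }1\;\dots\;1\;0\;1\;\dots\;k{ - }1]$, $S_{22}(k)=[k{ - }1\;\dots\;1\;0\;0\;1\;\dots\;k{ - }1]$,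 $S(k)=[0\;1\;\dots\;k{ - }1]$. -}

module Defs where

open import Data.Nat using (ℕ; zero; suc; _∸_; _+_; _<_; _≤_)
open import Data.Integer as ℤ using (ℤ; +_)
open import Data.Integer.DivMod using (_%ℕ_)
open import Data.Fin using (Fin; _≟_; fromℕ<)
open import Data.List using (List; []; _∷_; _++_; length; filter; upTo; allFin; map; reverse)
open import Data.Product using (Σ; ∃; _×_; _,_)
open import Relation.Binary.PropositionalEquality using (_≡_)
open import Relation.Nullary using (does)
open import Data.Bool using (if_then_else_)
open import Function.Bundles using (_⇔_)

-- Vertex v_{ij} of Γ = C_∞ · \overline{K_n} is the pair (i , j), i ∈ ℤ, j ∈ Fin n.
-- A coloring with c colors (colors = Fin c), written curried.
Coloring : ℕ → ℕ → Set
Coloring n c = ℤ → Fin n → Fin c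

countBlock : ∀ {n c} → (Fin n → Fin c) → Fin c → ℕ
countBlock {n} f b = length (filter (λ j → f j ≟ b) (allFin n))

-- number of neighbours of colour b of any vertex v_{ij}:
-- the neighbours of v_{ij} are exactly the vertices of V_{i-1} ∪ V_{i+1}
nbrCount : ∀ {n c} → Coloring n c → ℤ → Fin c → ℕ
nbrCount ψ i b = countBlock (ψ (i ℤ.- + 1)) b + countBlock (ψ (i ℤ.+ + 1)) b

UsesAll : ∀ {n c} → Coloring n c → Set
UsesAll {n} {c} ψ = (a : Fin c) → Σ ℤ λ i → Σ (Fin n) λ j → ψ i j ≡ a

Perfect : ∀ {n c} → Coloring n c → Set
Perfect {n} {c} ψ = Σ (Fin c → Fin c → ℕ) λ M →
  (i : ℤ) (j : Fin n) (b : Fin c) → nbrCount ψ i b ≡ M (ψ i j) b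

merge : ∀ {c} → Fin c → Fin c → Fin c → Fin c
merge a b x = if does (x ≟ b) then a else x

EquivColors : ∀ {n c} → Coloring n c → Fin c → Fin c → Set
EquivColors ψ a b = Perfect (λ i j → merge a b (ψ i j))

-- φ is a reduced coloring: obtained from some perfect coloring ψ (using all its
-- c colours) by identifying colours within each equivalence class, i.e.
-- φ = q ∘ ψ where q a ≡ q b exactly when a and b are equivalent.
Reduced : ∀ {n d} → Coloring n d → Set
Reduced {n} {d} φ = Σ ℕ λ c → Σ (Coloring n c) λ ψ →
  UsesAll ψ × Perfect ψ × Σ (Fin c → Fin d) λ q →
    ((a b : Fin c) → (q a ≡ q b) ⇔ EquivColors ψ a b) ×
    ((i : ℤ) (j : Fin n) → φ i j ≡ q (ψ i j))

nth : List ℕ → ℕ → ℕ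
nth [] _ = 0
nth (x ∷ xs) zero = x
nth (x ∷ xs) (suc m) = nth xs m

at : List ℕ → ℤ → ℕ
at [] m = 0
at (x ∷ xs) m = nth (x ∷ xs) (m %ℕ suc (length xs))

down : ℕ → List ℕ
down k = reverse (upTo k)

S11 : ℕ → List ℕ
S11 k = down k ++ map suc (upTo (k ∸ 2))

S12 : ℕ → List ℕ
S12 k = down k ++ map suc (upTo (k ∸ 1))

S22 : ℕ → List ℕ
S22 k = down k ++ upTo k

Scyc : ℕ → List ℕ
Scyc k = upTo k

-- In a reduced colouring every block is monochrome, and two blocks of the same
-- colour see the same unordered pair of neighbouring block colours: their colours
-- may be identified, and in the resulting perfect colouring vertices of the two
-- blocks have equal neighbour counts.  Propagating this local symmetry shows that
-- whenever two blocks share a colour, the colour sequence around one is a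
-- translate or a mirror image of the sequence around the other; this survives
-- passing to one parity class.  A finite-valued sequence with this property has a
-- least period p (by pigeonhole every long window yields a period or a reflection
-- centre, and two centres yield a period).  If the values on one period are
-- distinct the sequence is cyclic, S(p); otherwise a repeated value forces a
-- reflection centre, and minimality of p makes the values between two consecutive
-- centres distinct.  The parities of the centre and of p then give S11, S12 or S22.

module Submission where

open import Defs
open import Level using (0ℓ)
open import Data.Bool using (if_then_else_)
open import Data.Empty using (⊥-elim)
open import Data.Fin as Fin using (Fin; fromℕ<; toℕ)
open import Data.Fin.Properties using (pigeonhole; toℕ<n)
open import Data.Integer as ℤ using (ℤ; +_; -[1+_]; 1ℤ; -1ℤ)
open import Data.Integer.DivMod using (_%ℕ_; _/ℕ_; a≡a%ℕn+[a/ℕn]*n; n%ℕd<d)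
import Data.Integer.Properties as ℤ
open import Data.Integer.Tactic.RingSolver using (solve-∀)
open import Data.List
  using (List; []; _∷_; _++_; length; map; upTo; downFrom; applyUpTo; filter; allFin)
open import Data.List.Membership.Propositional.Properties using (∈-allFin)
open import Data.List.Properties
  using ( length-++; length-map; length-upTo; length-downFrom; reverse-upTo; map-upTo
        ; filter-some; filter-none; filter-≐)
import Data.List.Relation.Unary.All as All
open import Data.List.Relation.Unary.All.Properties using (all-filter)
import Data.List.Relation.Unary.Any as Any
open import Data.Nat as ℕ using (ℕ; zero; suc; z≤n; s≤s; z<s; _≤_; _<_; NonZero)
open import Data.Nat.Induction using (<-rec)
import Data.Nat.Properties as ℕ
open import Algebra.Properties.CommutativeSemigroup ℕ.+-commutativeSemigroup using (interchange)
import Data.Nat.Tactic.RingSolver as ℕ-Solver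
open import Data.Product using (Σ; ∃; ∃₂; _×_; _,_; proj₁; proj₂)
open import Data.Sum as Sum using (_⊎_; inj₁; inj₂)
open import Function.Bundles using (Equivalence; _⇔_)
open import Relation.Binary using (tri<; tri≈; tri>)
open import Relation.Binary.PropositionalEquality
  using (_≡_; _≢_; refl; sym; trans; cong; cong₂; subst; subst₂; module ≡-Reasoning)
open import Relation.Nullary using (Dec; yes; no; ¬_; does)
open import Relation.Nullary.Decidable using (_×-dec_; _⊎-dec_)
open import Relation.Unary using (Pred; Decidable)

-- Local symmetry and its propagation

SamePair : {A : Set} → A → A → A → A → Set
SamePair x y u v = (x ≡ u × y ≡ v) ⊎ (x ≡ v × y ≡ u)

OneOf : {A : Set} → A → A → A → Set
OneOf z x y = z ≡ x ⊎ z ≡ y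

module _ {A : Set} {x y u v : A} where

  samePair-cancelˡ : SamePair x y u v → x ≡ u → y ≡ v
  samePair-cancelˡ (inj₁ (_ , y≡v)) _ = y≡v
  samePair-cancelˡ (inj₂ (x≡v , y≡u)) x≡u = trans y≡u (trans (sym x≡u) x≡v)

  samePair-swapˡ : SamePair x y u v → SamePair y x u v
  samePair-swapˡ (inj₁ (x≡u , y≡v)) = inj₂ (y≡v , x≡u)
  samePair-swapˡ (inj₂ (x≡v , y≡u)) = inj₁ (y≡u , x≡v)

  samePair-swapʳ : SamePair x y u v → SamePair x y v u
  samePair-swapʳ (inj₁ p) = inj₂ p
  samePair-swapʳ (inj₂ p) = inj₁ p

  samePair-subst : ∀ {x' y' u' v'} → x ≡ x' → y ≡ y' → u ≡ u' → v ≡ v' →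
    SamePair x y u v → SamePair x' y' u' v'
  samePair-subst refl refl refl refl p = p

  oneOf⇒samePair : OneOf x u v → OneOf y u v → OneOf u x y → OneOf v x y → SamePair x y u v
  oneOf⇒samePair (inj₁ x≡u) (inj₂ y≡v) _ _ = inj₁ (x≡u , y≡v)
  oneOf⇒samePair (inj₂ x≡v) (inj₁ y≡u) _ _ = inj₂ (x≡v , y≡u)
  oneOf⇒samePair (inj₁ x≡u) (inj₁ y≡u) _ (inj₁ v≡x) =
    inj₁ (x≡u , trans y≡u (trans (sym x≡u) (sym v≡x)))
  oneOf⇒samePair (inj₁ x≡u) (inj₁ y≡u) _ (inj₂ v≡y) = inj₁ (x≡u , sym v≡y)
  oneOf⇒samePair (inj₂ x≡v) (inj₂ y≡v) (inj₁ u≡x) _ =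
    inj₂ (x≡v , trans y≡v (trans (sym x≡v) (sym u≡x)))
  oneOf⇒samePair (inj₂ x≡v) (inj₂ y≡v) (inj₂ u≡y) _ = inj₂ (x≡v , sym u≡y)

UnitStep : ℤ → Set
UnitStep δ = δ ≡ 1ℤ ⊎ δ ≡ -1ℤ

unitStep-neg : ∀ {δ} → UnitStep δ → UnitStep (ℤ.- δ)
unitStep-neg (inj₁ refl) = inj₂ refl
unitStep-neg (inj₂ refl) = inj₁ refl

unitStep-multiple : ∀ s → ∃₂ λ δ k → UnitStep δ × s ≡ + k ℤ.* δ
unitStep-multiple (+ k) = 1ℤ , k , inj₁ refl , sym (ℤ.*-identityʳ (+ k))
unitStep-multiple -[1+ k ] = -1ℤ , suc k , inj₂ refl ,
  trans (cong ℤ.-_ (sym (ℤ.*-identityʳ (+ suc k)))) (ℤ.neg-distribʳ-* (+ suc k) 1ℤ)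

LocallySymmetric : {A : Set} → (ℤ → A) → Set
LocallySymmetric g = ∀ i i' → g i ≡ g i' →
  SamePair (g (i ℤ.- 1ℤ)) (g (i ℤ.+ 1ℤ)) (g (i' ℤ.- 1ℤ)) (g (i' ℤ.+ 1ℤ))

TranslateOrReflect : {A : Set} → (ℤ → A) → Set
TranslateOrReflect g = ∀ i j → g i ≡ g j →
  (∀ s → g (i ℤ.+ s) ≡ g (j ℤ.+ s)) ⊎ (∀ s → g (i ℤ.+ s) ≡ g (j ℤ.- s))

module _ {A : Set} {g : ℤ → A} (locSym : LocallySymmetric g) where

  locallySymmetric-steps : ∀ {δ δ'} → UnitStep δ → UnitStep δ' → ∀ i i' → g i ≡ g i' →
    SamePair (g (i ℤ.- δ)) (g (i ℤ.+ δ)) (g (i' ℤ.- δ')) (g (i' ℤ.+ δ'))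
  locallySymmetric-steps (inj₁ refl) (inj₁ refl) i i' e = locSym i i' e
  locallySymmetric-steps (inj₁ refl) (inj₂ refl) i i' e = samePair-swapʳ (locSym i i' e)
  locallySymmetric-steps (inj₂ refl) (inj₁ refl) i i' e = samePair-swapˡ (locSym i i' e)
  locallySymmetric-steps (inj₂ refl) (inj₂ refl) i i' e = samePair-swapˡ (samePair-swapʳ (locSym i i' e))

  -- Two walks with agreeing first two values agree forever: at each step the
  -- local symmetry at the current positions determines the next value.
  locallySymmetric-walk : ∀ {δ δ'} → UnitStep δ → UnitStep δ' → ∀ {i j} →
    g i ≡ g j → g (i ℤ.+ δ) ≡ g (j ℤ.+ δ') → ∀ k → g (i ℤ.+ + k ℤ.* δ) ≡ g (j ℤ.+ + k ℤ.* δ')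
  locallySymmetric-walk {δ} {δ'} uδ uδ' {i} {j} e₀ e₁ k = proj₁ (agree k)
    where
    back : ∀ x K d → (x ℤ.+ (+ 1 ℤ.+ K) ℤ.* d) ℤ.- d ≡ x ℤ.+ K ℤ.* d
    back = solve-∀
    forth : ∀ x K d → (x ℤ.+ (+ 1 ℤ.+ K) ℤ.* d) ℤ.+ d ≡ x ℤ.+ (+ 2 ℤ.+ K) ℤ.* d
    forth = solve-∀
    start : ∀ x d → x ≡ x ℤ.+ + 0 ℤ.* d
    start = solve-∀
    once : ∀ x d → x ℤ.+ d ≡ x ℤ.+ + 1 ℤ.* d
    once = solve-∀

    agree : ∀ k → g (i ℤ.+ + k ℤ.* δ) ≡ g (j ℤ.+ + k ℤ.* δ')
                × g (i ℤ.+ + suc k ℤ.* δ) ≡ g (j ℤ.+ + suc k ℤ.* δ')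
    agree zero = subst₂ (λ x y → g x ≡ g y) (start i δ) (start j δ') e₀
               , subst₂ (λ x y → g x ≡ g y) (once i δ) (once j δ') e₁
    agree (suc k) with agree k
    ... | eₖ , eₖ₊₁ = eₖ₊₁ , samePair-cancelˡ step eₖ
      where
      step : SamePair (g (i ℤ.+ + k ℤ.* δ)) (g (i ℤ.+ + suc (suc k) ℤ.* δ))
                      (g (j ℤ.+ + k ℤ.* δ')) (g (j ℤ.+ + suc (suc k) ℤ.* δ'))
      step = samePair-subst (cong g (back i (+ k) δ)) (cong g (forth i (+ k) δ))
                            (cong g (back j (+ k) δ')) (cong g (forth j (+ k) δ'))
               (locallySymmetric-steps uδ uδ' _ _ eₖ₊₁)

  locallySymmetric⇒translateOrReflect : TranslateOrReflect g
  locallySymmetric⇒translateOrReflect i j e with locSym i j e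
  ... | inj₁ (e₋ , e₊) = inj₁ translate
    where
    firstStep : ∀ {δ} → UnitStep δ → g (i ℤ.+ δ) ≡ g (j ℤ.+ δ)
    firstStep (inj₁ refl) = e₊
    firstStep (inj₂ refl) = e₋
    translate : ∀ s → g (i ℤ.+ s) ≡ g (j ℤ.+ s)
    translate s with unitStep-multiple s
    ... | δ , k , uδ , refl = locallySymmetric-walk uδ uδ e (firstStep uδ) k
  ... | inj₂ (e₋₊ , e₊₋) = inj₂ reflect
    where
    firstStep : ∀ {δ} → UnitStep δ → g (i ℤ.+ δ) ≡ g (j ℤ.- δ)
    firstStep (inj₁ refl) = e₊₋
    firstStep (inj₂ refl) = e₋₊
    reflect : ∀ s → g (i ℤ.+ s) ≡ g (j ℤ.- s)
    reflect s with unitStep-multiple s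
    ... | δ , k , uδ , refl = trans (locallySymmetric-walk uδ (unitStep-neg uδ) e (firstStep uδ) k)
                                    (cong (λ x → g (j ℤ.+ x)) (sym (ℤ.neg-distribʳ-* (+ k) δ)))

translateOrReflect-affine : {A : Set} {g : ℤ → A} → TranslateOrReflect g →
  ∀ a e → TranslateOrReflect (λ m → g (a ℤ.* m ℤ.+ e))
translateOrReflect-affine {g = g} tr a e m m' eq with tr _ _ eq
... | inj₁ translate = inj₁ λ s →
  trans (cong g (expand a e m s)) (trans (translate (a ℤ.* s)) (cong g (sym (expand a e m' s))))
  where
  expand : ∀ a e x s → a ℤ.* (x ℤ.+ s) ℤ.+ e ≡ (a ℤ.* x ℤ.+ e) ℤ.+ a ℤ.* s
  expand = solve-∀
... | inj₂ reflect = inj₂ λ s →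
  trans (cong g (expand a e m s)) (trans (reflect (a ℤ.* s)) (cong g (sym (expand⁻ a e m' s))))
  where
  expand : ∀ a e x s → a ℤ.* (x ℤ.+ s) ℤ.+ e ≡ (a ℤ.* x ℤ.+ e) ℤ.+ a ℤ.* s
  expand = solve-∀
  expand⁻ : ∀ a e x s → a ℤ.* (x ℤ.- s) ℤ.+ e ≡ (a ℤ.* x ℤ.+ e) ℤ.- a ℤ.* s
  expand⁻ = solve-∀

-- Periods and reflection symmetries

module _ {A : Set} (h : ℤ → A) where

  IsPeriod : ℤ → Set
  IsPeriod p = ∀ x → h (x ℤ.+ p) ≡ h x

  ReflectionSymmetric : ℤ → Set
  ReflectionSymmetric c = ∀ x → h (c ℤ.- x) ≡ h x

  IsLeastPeriod : ℕ → Set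
  IsLeastPeriod p = IsPeriod (+ p) × (∀ {D} → 0 < D → D < p → ¬ IsPeriod (+ D))

module _ {A : Set} {h : ℤ → A} where

  translateOrReflect⇒period⊎symmetry : TranslateOrReflect h → ∀ a b → h a ≡ h b →
    IsPeriod h (b ℤ.- a) ⊎ ReflectionSymmetric h (a ℤ.+ b)
  translateOrReflect⇒period⊎symmetry tr a b e with tr a b e
  ... | inj₁ translate = inj₁ λ x →
    trans (cong h (sym (shift a b x))) (trans (sym (translate (x ℤ.- a))) (cong h (cancel a x)))
    where
    shift : ∀ a b x → b ℤ.+ (x ℤ.- a) ≡ x ℤ.+ (b ℤ.- a)
    shift = solve-∀
    cancel : ∀ a x → a ℤ.+ (x ℤ.- a) ≡ x
    cancel = solve-∀
  ... | inj₂ reflect = inj₂ λ x →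
    trans (cong h (sym (mirror a b x))) (trans (sym (reflect (x ℤ.- a))) (cong h (cancel a x)))
    where
    mirror : ∀ a b x → b ℤ.- (x ℤ.- a) ≡ (a ℤ.+ b) ℤ.- x
    mirror = solve-∀
    cancel : ∀ a x → a ℤ.+ (x ℤ.- a) ≡ x
    cancel = solve-∀

  symmetries⇒period : ∀ {c₁ c₂} → ReflectionSymmetric h c₁ → ReflectionSymmetric h c₂ →
    IsPeriod h (c₂ ℤ.- c₁)
  symmetries⇒period {c₁} {c₂} s₁ s₂ x =
    trans (cong h (compose c₁ c₂ x)) (trans (s₂ (c₁ ℤ.- x)) (s₁ x))
    where
    compose : ∀ c₁ c₂ x → x ℤ.+ (c₂ ℤ.- c₁) ≡ c₂ ℤ.- (c₁ ℤ.- x)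
    compose = solve-∀

  symmetry-shift : ∀ {c p} → ReflectionSymmetric h c → IsPeriod h p → ReflectionSymmetric h (c ℤ.+ p)
  symmetry-shift {c} {p} s per x = trans (cong h (regroup c p x)) (trans (per (c ℤ.- x)) (s x))
    where
    regroup : ∀ c p x → (c ℤ.+ p) ℤ.- x ≡ (c ℤ.- x) ℤ.+ p
    regroup = solve-∀

  period-neg : ∀ {p} → IsPeriod h p → IsPeriod h (ℤ.- p)
  period-neg {p} per x = trans (sym (per (x ℤ.- p))) (cong h (cancel x p))
    where
    cancel : ∀ x p → (x ℤ.- p) ℤ.+ p ≡ x
    cancel = solve-∀

  period-+ : ∀ {p q} → IsPeriod h p → IsPeriod h q → IsPeriod h (p ℤ.+ q)
  period-+ {p} {q} perₚ perq x = trans (cong h (sym (ℤ.+-assoc x p q))) (trans (perq (x ℤ.+ p)) (perₚ x))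

  period-*ℕ : ∀ {p} → IsPeriod h p → ∀ k → IsPeriod h (+ k ℤ.* p)
  period-*ℕ {p} per zero x = cong h (ℤ.+-identityʳ x)
  period-*ℕ {p} per (suc k) =
    subst (IsPeriod h) (sym (unfold (+ k) p)) (period-+ per (period-*ℕ per k))
    where
    unfold : ∀ k p → (+ 1 ℤ.+ k) ℤ.* p ≡ p ℤ.+ k ℤ.* p
    unfold = solve-∀

  period-* : ∀ {p} → IsPeriod h p → ∀ k → IsPeriod h (k ℤ.* p)
  period-* per (+ k) = period-*ℕ per k
  period-* {p} per -[1+ k ] =
    subst (IsPeriod h) (ℤ.neg-distribˡ-* (+ suc k) p) (period-neg (period-*ℕ per (suc k)))

  period-residue : ∀ {p} .{{_ : NonZero p}} → IsPeriod h (+ p) →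
    ∀ m t → h (m ℤ.+ t) ≡ h (+ (m %ℕ p) ℤ.+ t)
  period-residue {p} per m t =
    trans (cong h (trans (cong (ℤ._+ t) (a≡a%ℕn+[a/ℕn]*n m p)) (regroup (+ (m %ℕ p)) (m /ℕ p) (+ p) t)))
          (period-* per (m /ℕ p) _)
    where
    regroup : ∀ r k p t → (r ℤ.+ k ℤ.* p) ℤ.+ t ≡ (r ℤ.+ t) ℤ.+ k ℤ.* p
    regroup = solve-∀

  period-from-residues : ∀ {p} .{{_ : NonZero p}} → IsPeriod h (+ p) →
    ∀ q → (∀ x → x < p → h (+ x ℤ.+ q) ≡ h (+ x)) → IsPeriod h q
  period-from-residues {p} per q onResidues x =
    trans (period-residue per x q) (trans (onResidues (x %ℕ p) (n%ℕd<d x p)) (sym residue))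
    where
    residue : h x ≡ h (+ (x %ℕ p))
    residue = subst₂ (λ y z → h y ≡ h z) (ℤ.+-identityʳ x) (ℤ.+-identityʳ _) (period-residue per x (+ 0))

  period-extends-pattern : ∀ {q} → IsPeriod h (+ suc q) → (P : List ℕ) → length P ≡ suc q →
    ∀ t (r : ℕ → A) → (∀ u → u < suc q → h (+ u ℤ.+ t) ≡ r (nth P u)) →
    ∀ m → h (m ℤ.+ t) ≡ r (at P m)
  period-extends-pattern {q} per (x ∷ xs) refl t r onPeriod m =
    trans (period-residue per m t) (onPeriod (m %ℕ suc q) (n%ℕd<d m (suc q)))

  translateOrReflect⇒period⊎symmetryℕ : TranslateOrReflect h → ∀ x e → h (+ x) ≡ h (+ suc (x ℕ.+ e)) →
    IsPeriod h (+ suc e) ⊎ ReflectionSymmetric h (+ (x ℕ.+ suc (x ℕ.+ e)))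
  translateOrReflect⇒period⊎symmetryℕ tr x e eq =
    Sum.map₁ (subst (IsPeriod h) (difference (+ x) (+ e))) (translateOrReflect⇒period⊎symmetry tr _ _ eq)
    where
    difference : ∀ x e → (+ 1 ℤ.+ (x ℤ.+ e)) ℤ.- x ≡ + 1 ℤ.+ e
    difference = solve-∀

  symmetries⇒periodℕ : ∀ c D → ReflectionSymmetric h (+ c) → ReflectionSymmetric h (+ (c ℕ.+ D)) →
    IsPeriod h (+ D)
  symmetries⇒periodℕ c D s₁ s₂ =
    subst (IsPeriod h) (difference (+ c) (+ D)) (symmetries⇒period {c₁ = + c} {c₂ = + (c ℕ.+ D)} s₁ s₂)
    where
    difference : ∀ c D → (c ℤ.+ D) ℤ.- c ≡ D
    difference = solve-∀

module _ {d : ℕ} {h : ℤ → Fin d} where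

  period? : ∀ {p} .{{_ : NonZero p}} → IsPeriod h (+ p) → ∀ q → Dec (IsPeriod h q)
  period? {p} per q with ℕ.allUpTo? (λ x → h (+ x ℤ.+ q) Fin.≟ h (+ x)) p
  ... | yes onResidues = yes (period-from-residues per q λ x x<p → onResidues x<p)
  ... | no ¬onResidues = no λ perq → ¬onResidues λ {x} _ → perq (+ x)

  least-period : ∀ p → IsPeriod h (+ suc p) → ∃ λ q → IsLeastPeriod h (suc q)
  least-period = <-rec _ descend
    where
    descend : ∀ p → (∀ {p'} → p' < p → IsPeriod h (+ suc p') → ∃ λ q → IsLeastPeriod h (suc q)) →
      IsPeriod h (+ suc p) → ∃ λ q → IsLeastPeriod h (suc q)
    descend p smaller per with ℕ.anyUpTo? (λ D → (0 ℕ.<? D) ×-dec period? per (+ D)) (suc p)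
    ... | yes (suc D , s≤s D<p , _ , perD) = smaller D<p perD
    ... | no none = p , per , λ 0<D D<p perD → none (_ , D<p , 0<D , perD)

  collision-in-window : ∀ N → ∃₂ λ i j → i < j × j ≤ d × h (+ (N ℕ.+ i)) ≡ h (+ (N ℕ.+ j))
  collision-in-window N with pigeonhole (ℕ.n<1+n d) (λ i → h (+ (N ℕ.+ toℕ i)))
  ... | i , j , i<j , eq = toℕ i , toℕ j , i<j , ℕ.≤-pred (toℕ<n j) , eq

  window-period⊎symmetry : TranslateOrReflect h → ∀ N →
    (∃ λ p → IsPeriod h (+ suc p)) ⊎
    (∃ λ c → N ℕ.+ N ≤ c × c ≤ (N ℕ.+ d) ℕ.+ (N ℕ.+ d) × ReflectionSymmetric h (+ c))
  window-period⊎symmetry tr N with collision-in-window N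
  ... | i , j , i<j , j≤d , eq with ℕ.m≤n⇒∃[o]m+o≡n i<j
  ...   | e , refl = Sum.map (e ,_) (λ mirror → _ , subst (N ℕ.+ N ≤_) centre lower ,
                                                  subst (_≤ (N ℕ.+ d) ℕ.+ (N ℕ.+ d)) centre upper , mirror)
                             (translateOrReflect⇒period⊎symmetryℕ tr (N ℕ.+ i) e
                               (trans eq (cong (λ y → h (+ y)) shift)))
    where
    shift : N ℕ.+ suc (i ℕ.+ e) ≡ suc (N ℕ.+ i ℕ.+ e)
    shift = trans (ℕ.+-suc N _) (cong suc (sym (ℕ.+-assoc N i e)))
    centre : (N ℕ.+ i) ℕ.+ (N ℕ.+ suc (i ℕ.+ e)) ≡ (N ℕ.+ i) ℕ.+ suc (N ℕ.+ i ℕ.+ e)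
    centre = cong ((N ℕ.+ i) ℕ.+_) shift
    lower : N ℕ.+ N ≤ (N ℕ.+ i) ℕ.+ (N ℕ.+ suc (i ℕ.+ e))
    lower = ℕ.+-mono-≤ (ℕ.m≤m+n N i) (ℕ.m≤m+n N _)
    upper : (N ℕ.+ i) ℕ.+ (N ℕ.+ suc (i ℕ.+ e)) ≤ (N ℕ.+ d) ℕ.+ (N ℕ.+ d)
    upper = ℕ.+-mono-≤ (ℕ.+-monoʳ-≤ N (ℕ.<⇒≤ (ℕ.<-≤-trans i<j j≤d))) (ℕ.+-monoʳ-≤ N j≤d)

  -- A window of d + 1 consecutive values contains a repeated value, hence a period
  -- or a reflection centre inside the window; the centres of two disjoint windows
  -- differ by a period.
  exists-period : TranslateOrReflect h → ∃ λ p → IsPeriod h (+ suc p)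
  exists-period tr with window-period⊎symmetry tr 0 | window-period⊎symmetry tr (suc (d ℕ.+ d))
  ... | inj₁ per | _ = per
  ... | inj₂ _ | inj₁ per = per
  ... | inj₂ (c₁ , _ , c₁≤2d , s₁) | inj₂ (c₂ , 2d<c₂ , _ , s₂)
    with ℕ.m≤n⇒∃[o]m+o≡n (ℕ.<-≤-trans (s≤s c₁≤2d) (ℕ.≤-trans (ℕ.m≤m+n _ _) 2d<c₂))
  ...   | e , refl =
    e , symmetries⇒periodℕ c₁ (suc e) s₁ (subst (λ c → ReflectionSymmetric h (+ c)) (sym (ℕ.+-suc c₁ e)) s₂)

-- The period patterns

even-or-odd : ∀ n → ∃ λ m → n ≡ m ℕ.+ m ⊎ n ≡ suc (m ℕ.+ m)
even-or-odd zero = 0 , inj₁ refl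
even-or-odd (suc n) with even-or-odd n
... | m , inj₁ refl = m , inj₂ refl
... | m , inj₂ refl = suc m , inj₁ (cong suc (sym (ℕ.+-suc m m)))

length-down : ∀ k → length (down k) ≡ k
length-down k = trans (cong length (reverse-upTo k)) (length-downFrom k)

nth-downFrom-++ : ∀ k (ys : List ℕ) {u w} → suc (u ℕ.+ w) ≡ k → nth (downFrom k ++ ys) u ≡ w
nth-downFrom-++ (suc k) ys {zero} refl = refl
nth-downFrom-++ (suc k) ys {suc u} eq = nth-downFrom-++ k ys (ℕ.suc-injective eq)

nth-down-++ : ∀ k (ys : List ℕ) {u w} → suc (u ℕ.+ w) ≡ k → nth (down k ++ ys) u ≡ w
nth-down-++ k ys {u} eq = trans (cong (λ xs → nth (xs ++ ys) u) (reverse-upTo k)) (nth-downFrom-++ k ys eq)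

nth-++-length : ∀ (xs ys : List ℕ) w → nth (xs ++ ys) (length xs ℕ.+ w) ≡ nth ys w
nth-++-length [] ys w = refl
nth-++-length (x ∷ xs) ys w = nth-++-length xs ys w

nth-down-++-offset : ∀ k (ys : List ℕ) w → nth (down k ++ ys) (k ℕ.+ w) ≡ nth ys w
nth-down-++-offset k ys w =
  trans (cong (λ n → nth (down k ++ ys) (n ℕ.+ w)) (sym (length-down k))) (nth-++-length (down k) ys w)

nth-applyUpTo : ∀ (f : ℕ → ℕ) n {u} → u < n → nth (applyUpTo f n) u ≡ f u
nth-applyUpTo f (suc n) {zero} _ = refl
nth-applyUpTo f (suc n) {suc u} (s≤s u<n) = nth-applyUpTo (λ z → f (suc z)) n u<n

nth-upTo : ∀ n {u} → u < n → nth (upTo n) u ≡ u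
nth-upTo = nth-applyUpTo (λ z → z)

nth-map-suc-upTo : ∀ n {u} → u < n → nth (map suc (upTo n)) u ≡ suc u
nth-map-suc-upTo n {u} u<n = trans (cong (λ xs → nth xs u) (map-upTo suc n)) (nth-applyUpTo suc n u<n)

module _ {A : Set} (k : ℕ) (r : ℕ → A)
  (distinct : ∀ a e → suc (a ℕ.+ e) < k → r a ≢ r (suc (a ℕ.+ e))) where

  distinct-below : ∀ {a b} → a < b → b < k → r a ≢ r b
  distinct-below a<b b<k with ℕ.m≤n⇒∃[o]m+o≡n a<b
  ... | e , refl = distinct _ e b<k

  injective-below : (a b : ℕ) → a < k → b < k → r a ≡ r b → a ≡ b
  injective-below a b a<k b<k eq with ℕ.<-cmp a b
  ... | tri< a<b _ _ = ⊥-elim (distinct-below a<b b<k eq)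
  ... | tri≈ _ a≡b _ = a≡b
  ... | tri> _ _ b<a = ⊥-elim (distinct-below b<a a<k (sym eq))

module _ {A : Set} where

  MatchesPattern : (ℤ → A) → ℕ → List ℕ → Set
  MatchesPattern h k P = Σ ℤ λ t → Σ (ℕ → A) λ r →
    ((a b : ℕ) → a < k → b < k → r a ≡ r b → a ≡ b) × ((m : ℤ) → h (m ℤ.+ t) ≡ r (at P m))

  FollowsPattern : (ℤ → A) → Set
  FollowsPattern h = Σ ℕ λ k → 1 ≤ k × Σ (List ℕ) λ P →
    (P ≡ S11 k ⊎ P ≡ S12 k ⊎ P ≡ S22 k ⊎ P ≡ Scyc k) × MatchesPattern h k P

-- Classification of finite-valued sequences

module Classification {d : ℕ} {h : ℤ → Fin d} (tr : TranslateOrReflect h)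
  {q : ℕ} (least : IsLeastPeriod h (suc q)) where

  open ≡-Reasoning

  distinct-near-symmetry : ∀ {C x e D} → ReflectionSymmetric h (+ C) → C ℕ.+ D ≡ x ℕ.+ suc (x ℕ.+ e) →
    0 < D → D < suc q → suc e < suc q → h (+ x) ≢ h (+ suc (x ℕ.+ e))
  distinct-near-symmetry {C} {x} {e} {D} mirror centre 0<D D<p e<p eq
    with translateOrReflect⇒period⊎symmetryℕ tr x e eq
  ... | inj₁ per = proj₂ least z<s e<p per
  ... | inj₂ mirror' = proj₂ least 0<D D<p
    (symmetries⇒periodℕ C D mirror (subst (λ c → ReflectionSymmetric h (+ c)) (sym centre) mirror'))

  cyclic-matchesPattern : (∀ a e → suc (a ℕ.+ e) < suc q → h (+ a) ≢ h (+ suc (a ℕ.+ e))) →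
    MatchesPattern h (suc q) (upTo (suc q))
  cyclic-matchesPattern distinct = + 0 , (λ a → h (+ a)) , injective-below (suc q) _ distinct ,
    period-extends-pattern (proj₁ least) (upTo (suc q)) (length-upTo (suc q)) (+ 0) (λ a → h (+ a)) onPeriod
    where
    onPeriod : ∀ u → u < suc q → h (+ u ℤ.+ + 0) ≡ h (+ nth (upTo (suc q)) u)
    onPeriod u u<p = cong h (trans (ℤ.+-identityʳ (+ u)) (cong +_ (sym (nth-upTo (suc q) u<p))))

  -- The reflection centre is A and r a is the value at distance a from it; one
  -- period starts K places to the left of the centre.
  evenCentre-matchesPattern : ∀ A K L → ReflectionSymmetric h (+ (A ℕ.+ A)) →
    suc q ≡ suc K ℕ.+ L → K ≤ suc L →
    MatchesPattern h (suc K) (down (suc K) ++ map suc (upTo L))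
  evenCentre-matchesPattern A K L mirror p≡ K≤1+L = + A ℤ.- + K , r , injective-below (suc K) r distinct ,
    period-extends-pattern (proj₁ least) P length-P _ r onPeriod
    where
    r : ℕ → Fin d
    r a = h (+ (A ℕ.+ a))
    P : List ℕ
    P = down (suc K) ++ map suc (upTo L)
    length-P : length P ≡ suc q
    length-P = trans (length-++ (down (suc K)))
      (trans (cong₂ ℕ._+_ (length-down (suc K)) (trans (length-map suc (upTo L)) (length-upTo L))) (sym p≡))

    distinct : ∀ a e → suc (a ℕ.+ e) < suc K → r a ≢ r (suc (a ℕ.+ e))
    distinct a e b<k eq = distinct-near-symmetry mirror (centre A a e) 0<D D<p e<p
      (trans eq (cong (λ y → h (+ y)) (shift A a e)))
      where
      shift : ∀ A a e → A ℕ.+ suc (a ℕ.+ e) ≡ suc (A ℕ.+ a ℕ.+ e)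
      shift = ℕ-Solver.solve-∀
      centre : ∀ A a e → (A ℕ.+ A) ℕ.+ (a ℕ.+ suc (a ℕ.+ e)) ≡ (A ℕ.+ a) ℕ.+ suc (A ℕ.+ a ℕ.+ e)
      centre = ℕ-Solver.solve-∀
      b≤K : suc (a ℕ.+ e) ≤ K
      b≤K = ℕ.≤-pred b<k
      a≤L : a ≤ L
      a≤L = ℕ.≤-pred (ℕ.≤-trans (s≤s (ℕ.m≤m+n a e)) (ℕ.≤-trans b≤K K≤1+L))
      0<D : 0 < a ℕ.+ suc (a ℕ.+ e)
      0<D = ℕ.<-≤-trans z<s (ℕ.m≤n+m _ a)
      D<p : a ℕ.+ suc (a ℕ.+ e) < suc q
      D<p = subst (a ℕ.+ suc (a ℕ.+ e) <_) (sym p≡)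
        (s≤s (subst (a ℕ.+ suc (a ℕ.+ e) ≤_) (ℕ.+-comm L K) (ℕ.+-mono-≤ a≤L b≤K)))
      e<p : suc e < suc q
      e<p = subst (suc e <_) (sym p≡)
        (s≤s (ℕ.≤-trans (s≤s (ℕ.m≤n+m e a)) (ℕ.≤-trans b≤K (ℕ.m≤m+n K L))))

    onPeriod : ∀ u → u < suc q → h (+ u ℤ.+ (+ A ℤ.- + K)) ≡ r (nth P u)
    onPeriod u u<p with u ℕ.≤? K
    ... | yes u≤K with ℕ.m≤n⇒∃[o]m+o≡n u≤K
    ...   | w , u+w≡K = begin
      h (+ u ℤ.+ (+ A ℤ.- + K))           ≡⟨ cong (λ k → h (+ u ℤ.+ (+ A ℤ.- + k))) (sym u+w≡K) ⟩
      h (+ u ℤ.+ (+ A ℤ.- + (u ℕ.+ w)))   ≡⟨ cong h (left (+ u) (+ w) (+ A)) ⟩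
      h (+ (A ℕ.+ A) ℤ.- + (A ℕ.+ w))     ≡⟨ mirror (+ (A ℕ.+ w)) ⟩
      r w                                 ≡⟨ cong r (sym (nth-down-++ (suc K) _ (cong suc u+w≡K))) ⟩
      r (nth P u)                         ∎
      where
      left : ∀ u w A → u ℤ.+ (A ℤ.- (u ℤ.+ w)) ≡ (A ℤ.+ A) ℤ.- (A ℤ.+ w)
      left = solve-∀
    onPeriod u u<p | no u≰K with ℕ.m≤n⇒∃[o]m+o≡n (ℕ.≰⇒> u≰K)
    ...   | w , refl = trans (cong h (right (+ K) (+ w) (+ A)))
                         (cong r (sym (trans (nth-down-++-offset (suc K) _ w) (nth-map-suc-upTo L w<L))))
      where
      right : ∀ K w A → (+ 1 ℤ.+ (K ℤ.+ w)) ℤ.+ (A ℤ.- K) ≡ A ℤ.+ (+ 1 ℤ.+ w)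
      right = solve-∀
      w<L : w < L
      w<L = ℕ.+-cancelˡ-< (suc K) w L (subst (suc K ℕ.+ w <_) p≡ u<p)

  -- The reflection centre is A + 1/2 and r a is the value at A + 1 + a.
  oddCentre-matchesPattern : ∀ A K → ReflectionSymmetric h (+ suc (A ℕ.+ A)) → suc q ≡ suc K ℕ.+ suc K →
    MatchesPattern h (suc K) (down (suc K) ++ upTo (suc K))
  oddCentre-matchesPattern A K mirror p≡ = + suc A ℤ.- + suc K , r , injective-below (suc K) r distinct ,
    period-extends-pattern (proj₁ least) P length-P _ r onPeriod
    where
    r : ℕ → Fin d
    r a = h (+ (A ℕ.+ suc a))
    P : List ℕ
    P = down (suc K) ++ upTo (suc K)
    length-P : length P ≡ suc q
    length-P = trans (length-++ (down (suc K)))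
      (trans (cong₂ ℕ._+_ (length-down (suc K)) (length-upTo (suc K))) (sym p≡))

    distinct : ∀ a e → suc (a ℕ.+ e) < suc K → r a ≢ r (suc (a ℕ.+ e))
    distinct a e b<k eq = distinct-near-symmetry mirror (centre A a e) z<s D<p e<p
      (trans eq (cong (λ y → h (+ y)) (shift A a e)))
      where
      shift : ∀ A a e → A ℕ.+ suc (suc (a ℕ.+ e)) ≡ suc (A ℕ.+ suc a ℕ.+ e)
      shift = ℕ-Solver.solve-∀
      centre : ∀ A a e →
        suc (A ℕ.+ A) ℕ.+ (suc a ℕ.+ suc (a ℕ.+ e)) ≡ (A ℕ.+ suc a) ℕ.+ suc (A ℕ.+ suc a ℕ.+ e)
      centre = ℕ-Solver.solve-∀
      D<p : suc a ℕ.+ suc (a ℕ.+ e) < suc q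
      D<p = subst (suc a ℕ.+ suc (a ℕ.+ e) <_) (sym p≡)
        (ℕ.+-mono-< (ℕ.≤-<-trans (s≤s (ℕ.m≤m+n a e)) b<k) b<k)
      e<p : suc e < suc q
      e<p = subst (suc e <_) (sym p≡)
        (ℕ.≤-trans (ℕ.≤-<-trans (s≤s (ℕ.m≤n+m e a)) b<k) (ℕ.m≤m+n (suc K) (suc K)))

    onPeriod : ∀ u → u < suc q → h (+ u ℤ.+ (+ suc A ℤ.- + suc K)) ≡ r (nth P u)
    onPeriod u u<p with u ℕ.<? suc K
    ... | yes u<k with ℕ.m≤n⇒∃[o]m+o≡n u<k
    ...   | w , 1+u+w≡1+K = begin
      h (+ u ℤ.+ (+ suc A ℤ.- + suc K))           ≡⟨ cong (λ k → h (+ u ℤ.+ (+ suc A ℤ.- + k))) (sym 1+u+w≡1+K) ⟩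
      h (+ u ℤ.+ (+ suc A ℤ.- + suc (u ℕ.+ w)))   ≡⟨ cong h (left (+ u) (+ w) (+ A)) ⟩
      h (+ suc (A ℕ.+ A) ℤ.- + (A ℕ.+ suc w))     ≡⟨ mirror (+ (A ℕ.+ suc w)) ⟩
      r w                                         ≡⟨ cong r (sym (nth-down-++ (suc K) _ 1+u+w≡1+K)) ⟩
      r (nth P u)                                 ∎
      where
      left : ∀ u w A →
        u ℤ.+ ((+ 1 ℤ.+ A) ℤ.- (+ 1 ℤ.+ (u ℤ.+ w))) ≡ (+ 1 ℤ.+ (A ℤ.+ A)) ℤ.- (A ℤ.+ (+ 1 ℤ.+ w))
      left = solve-∀
    onPeriod u u<p | no u≮k with ℕ.m≤n⇒∃[o]m+o≡n (ℕ.≮⇒≥ u≮k)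
    ...   | w , refl = trans (cong h (right (+ K) (+ w) (+ A)))
                         (cong r (sym (trans (nth-down-++-offset (suc K) _ w) (nth-upTo (suc K) w<k))))
      where
      right : ∀ K w A → ((+ 1 ℤ.+ K) ℤ.+ w) ℤ.+ ((+ 1 ℤ.+ A) ℤ.- (+ 1 ℤ.+ K)) ≡ A ℤ.+ (+ 1 ℤ.+ w)
      right = solve-∀
      w<k : w < suc K
      w<k = ℕ.+-cancelˡ-< (suc K) w (suc K) (subst (suc K ℕ.+ w <_) p≡ u<p)

  evenCentre⇒followsPattern : ∀ A → ReflectionSymmetric h (+ (A ℕ.+ A)) → FollowsPattern h
  evenCentre⇒followsPattern A mirror with even-or-odd (suc q)
  ... | zero , inj₁ ()
  ... | suc K , inj₁ p≡ = suc (suc K) , s≤s z≤n , _ , inj₁ refl ,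
    evenCentre-matchesPattern A (suc K) K mirror (trans p≡ (ℕ.+-suc (suc K) K)) ℕ.≤-refl
  ... | K , inj₂ p≡ = suc K , s≤s z≤n , _ , inj₂ (inj₁ refl) ,
    evenCentre-matchesPattern A K K mirror p≡ (ℕ.n≤1+n K)

  symmetry⇒followsPattern : ∀ C → ReflectionSymmetric h (+ C) → FollowsPattern h
  symmetry⇒followsPattern C mirror with even-or-odd C | even-or-odd (suc q)
  ... | A , inj₁ refl | _ = evenCentre⇒followsPattern A mirror
  ... | A , inj₂ refl | zero , inj₁ ()
  ... | A , inj₂ refl | suc K , inj₁ p≡ =
    suc K , s≤s z≤n , _ , inj₂ (inj₂ (inj₁ refl)) , oddCentre-matchesPattern A K mirror p≡
  ... | A , inj₂ refl | K , inj₂ p≡ = evenCentre⇒followsPattern (suc (A ℕ.+ K))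
    (subst (λ c → ReflectionSymmetric h (+ c)) (trans (cong (suc (A ℕ.+ A) ℕ.+_) p≡) (recentre A K))
      (symmetry-shift {c = + suc (A ℕ.+ A)} mirror (proj₁ least)))
    where
    recentre : ∀ A K → suc (A ℕ.+ A) ℕ.+ suc (K ℕ.+ K) ≡ suc (A ℕ.+ K) ℕ.+ suc (A ℕ.+ K)
    recentre = ℕ-Solver.solve-∀

  leastPeriod⇒followsPattern : FollowsPattern h
  leastPeriod⇒followsPattern with ℕ.anyUpTo? (λ b → ℕ.anyUpTo? (λ a → h (+ a) Fin.≟ h (+ b)) b) (suc q)
  ... | no none = suc q , s≤s z≤n , _ , inj₂ (inj₂ (inj₂ refl)) ,
    cyclic-matchesPattern λ a e b<p eq → none (_ , b<p , a , s≤s (ℕ.m≤m+n a e) , eq)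
  ... | yes (b , b<p , a , a<b , eq) with ℕ.m≤n⇒∃[o]m+o≡n a<b
  ...   | e , refl with translateOrReflect⇒period⊎symmetryℕ tr a e eq
  ...     | inj₁ per = ⊥-elim (proj₂ least z<s (ℕ.≤-<-trans (s≤s (ℕ.m≤n+m e a)) b<p) per)
  ...     | inj₂ mirror = symmetry⇒followsPattern _ mirror

translateOrReflect⇒followsPattern : ∀ {d} {h : ℤ → Fin d} → TranslateOrReflect h → FollowsPattern h
translateOrReflect⇒followsPattern tr with exists-period tr
... | p , per with least-period p per
...   | q , least = Classification.leastPeriod⇒followsPattern tr least

-- Reduced colourings of Γ

module _ {A : Set} {P Q : Pred A 0ℓ} (P? : Decidable P) (Q? : Decidable Q) where

  length-filter-⊎ : (∀ {x} → P x → ¬ Q x) → ∀ xs →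
    length (filter (λ x → P? x ⊎-dec Q? x) xs) ≡ length (filter P? xs) ℕ.+ length (filter Q? xs)
  length-filter-⊎ disjoint [] = refl
  length-filter-⊎ disjoint (x ∷ xs) with P? x | Q? x | length-filter-⊎ disjoint xs
  ... | yes px | yes qx | _ = ⊥-elim (disjoint px qx)
  ... | yes _ | no _ | ih = cong suc ih
  ... | no _ | yes _ | ih = trans (cong suc ih) (sym (ℕ.+-suc _ _))
  ... | no _ | no _ | ih = ih

positive-sum : ∀ m n → 0 < m ℕ.+ n → 0 < m ⊎ 0 < n
positive-sum zero n pos = inj₂ pos
positive-sum (suc m) n _ = inj₁ z<s

module _ {n c : ℕ} where

  countBlock-positive : (f : Fin n → Fin c) {b : Fin c} (j : Fin n) → f j ≡ b → 0 < countBlock f b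
  countBlock-positive f {b} j fj≡b = filter-some (λ j → f j Fin.≟ b) (Any.map (λ { refl → fj≡b }) (∈-allFin j))

  countBlock-witness : (f : Fin n → Fin c) (b : Fin c) → 0 < countBlock f b → ∃ λ j → f j ≡ b
  countBlock-witness f b pos with filter (λ j → f j Fin.≟ b) (allFin n) | all-filter (λ j → f j Fin.≟ b) (allFin n)
  countBlock-witness f b () | [] | All.[]
  countBlock-witness f b pos | j ∷ _ | fj≡b All.∷ _ = j , fj≡b

module _ {c : ℕ} {a b : Fin c} where

  merge-≡ : ∀ {y} → y ≡ b → merge a b y ≡ a
  merge-≡ {y} y≡b with y Fin.≟ b
  ... | yes _ = refl
  ... | no y≢b = ⊥-elim (y≢b y≡b)

  merge-≢ : ∀ {y} → y ≢ b → merge a b y ≡ y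
  merge-≢ {y} y≢b with y Fin.≟ b
  ... | yes y≡b = ⊥-elim (y≢b y≡b)
  ... | no _ = refl

  merge-self : merge a b a ≡ a
  merge-self with a Fin.≟ b
  ... | yes _ = refl
  ... | no _ = refl

nbrCount-positive : ∀ {n c δ} (ψ : Coloring n c) → UnitStep δ → ∀ i j → 0 < nbrCount ψ i (ψ (i ℤ.+ δ) j)
nbrCount-positive ψ (inj₁ refl) i j = ℕ.<-≤-trans (countBlock-positive (ψ (i ℤ.+ 1ℤ)) j refl) (ℕ.m≤n+m _ _)
nbrCount-positive ψ (inj₂ refl) i j = ℕ.<-≤-trans (countBlock-positive (ψ (i ℤ.- 1ℤ)) j refl) (ℕ.m≤m+n _ _)

mergeCounts : ∀ {c} → Fin c → Fin c → (Fin c → ℕ) → Fin c → ℕ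
mergeCounts a b v x = if does (x Fin.≟ b) then 0 else if does (x Fin.≟ a) then v a ℕ.+ v b else v x

module _ {c : ℕ} (a b : Fin c) where

  mergeCounts-+ : ∀ v w x → mergeCounts a b (λ y → v y ℕ.+ w y) x ≡ mergeCounts a b v x ℕ.+ mergeCounts a b w x
  mergeCounts-+ v w x with x Fin.≟ b
  ... | yes _ = refl
  ... | no _ with x Fin.≟ a
  ...   | yes _ = interchange (v a) (w a) (v b) (w b)
  ...   | no _ = refl

  mergeCounts-cong : ∀ {v w} → (∀ y → v y ≡ w y) → ∀ x → mergeCounts a b v x ≡ mergeCounts a b w x
  mergeCounts-cong v≗w x with x Fin.≟ b
  ... | yes _ = refl
  ... | no _ with x Fin.≟ a
  ...   | yes _ = cong₂ ℕ._+_ (v≗w a) (v≗w b)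
  ...   | no _ = v≗w x

  countBlock-merge : ∀ {n} → a ≢ b → (f : Fin n → Fin c) → ∀ x →
    countBlock (λ j → merge a b (f j)) x ≡ mergeCounts a b (countBlock f) x
  countBlock-merge {n} a≢b f x with x Fin.≟ b
  ... | yes refl = cong length (filter-none (λ j → merge a x (f j) Fin.≟ x) (All.universal merged≢b (allFin n)))
    where
    merged≢b : ∀ j → merge a x (f j) ≢ x
    merged≢b j with f j Fin.≟ x
    ... | yes _ = a≢b
    ... | no fj≢b = fj≢b
  ... | no x≢b with x Fin.≟ a
  ...   | yes refl = trans
    (cong length (filter-≐ (λ j → merge x b (f j) Fin.≟ x) (λ j → (f j Fin.≟ x) ⊎-dec (f j Fin.≟ b))
                           (into , outof) (allFin n)))
    (length-filter-⊎ (λ j → f j Fin.≟ x) (λ j → f j Fin.≟ b) (λ fj≡a fj≡b → a≢b (trans (sym fj≡a) fj≡b))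
                     (allFin n))
    where
    into : ∀ {j} → merge x b (f j) ≡ x → f j ≡ x ⊎ f j ≡ b
    into {j} m≡a with f j Fin.≟ b
    ... | yes fj≡b = inj₂ fj≡b
    ... | no _ = inj₁ m≡a
    outof : ∀ {j} → f j ≡ x ⊎ f j ≡ b → merge x b (f j) ≡ x
    outof (inj₁ fj≡a) = trans (merge-≢ (λ fj≡b → a≢b (trans (sym fj≡a) fj≡b))) fj≡a
    outof (inj₂ fj≡b) = merge-≡ fj≡b
  ...   | no x≢a =
    cong length (filter-≐ (λ j → merge a b (f j) Fin.≟ x) (λ j → f j Fin.≟ x) (into , outof) (allFin n))
    where
    into : ∀ {j} → merge a b (f j) ≡ x → f j ≡ x
    into {j} m≡x with f j Fin.≟ b
    ... | yes _ = ⊥-elim (x≢a (sym m≡x))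
    ... | no _ = m≡x
    outof : ∀ {j} → f j ≡ x → merge a b (f j) ≡ x
    outof fj≡x = trans (merge-≢ (λ fj≡b → x≢b (trans (sym fj≡x) fj≡b))) fj≡x

  nbrCount-merge : ∀ {n} → a ≢ b → (ψ : Coloring n c) → ∀ i x →
    nbrCount (λ i j → merge a b (ψ i j)) i x ≡ mergeCounts a b (nbrCount ψ i) x
  nbrCount-merge a≢b ψ i x =
    trans (cong₂ ℕ._+_ (countBlock-merge a≢b (ψ (i ℤ.- 1ℤ)) x) (countBlock-merge a≢b (ψ (i ℤ.+ 1ℤ)) x))
          (sym (mergeCounts-+ (countBlock (ψ (i ℤ.- 1ℤ))) (countBlock (ψ (i ℤ.+ 1ℤ))) x))

-- Vertices of one block have the same neighbours, so their colours have the same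
-- row in the parameter matrix, and identifying two colours with equal rows keeps
-- the colouring perfect.
sameBlock-equivalent : ∀ {n c} {ψ : Coloring n c} → Perfect ψ → ∀ i {j j'} → ψ i j ≢ ψ i j' →
  EquivColors ψ (ψ i j) (ψ i j')
sameBlock-equivalent {ψ = ψ} (M , perfect) i {j} {j'} a≢b =
  (λ y → mergeCounts a b (M y)) ,
  λ i' j'' x → trans (nbrCount-merge a b a≢b ψ i' x)
                     (mergeCounts-cong a b (λ y → trans (perfect i' j'' y) (mergedRow (ψ i' j'') y)) x)
  where
  a = ψ i j
  b = ψ i j'
  mergedRow : ∀ y x → M y x ≡ M (merge a b y) x
  mergedRow y x with y Fin.≟ b
  ... | yes refl = trans (sym (perfect i j' x)) (perfect i j x)
  ... | no _ = refl

locallySymmetric-≗ : ∀ {A : Set} {f g : ℤ → A} → (∀ i → f i ≡ g i) →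
  LocallySymmetric f → LocallySymmetric g
locallySymmetric-≗ f≗g locSym i i' eq =
  samePair-subst (f≗g _) (f≗g _) (f≗g _) (f≗g _) (locSym i i' (trans (f≗g i) (trans eq (sym (f≗g i')))))

module Reduction {n c d : ℕ} {ψ : Coloring n c} (perfect : Perfect ψ) (q : Fin c → Fin d)
  (q-equiv : ∀ a b → (q a ≡ q b) ⇔ EquivColors ψ a b) where

  reduced-blockwise : ∀ i j j' → q (ψ i j) ≡ q (ψ i j')
  reduced-blockwise i j j' with ψ i j Fin.≟ ψ i j'
  ... | yes eq = cong q eq
  ... | no neq = Equivalence.from (q-equiv _ _) (sameBlock-equivalent perfect i neq)

  q-merge : ∀ {a b} → q a ≡ q b → ∀ y → q (merge a b y) ≡ q y
  q-merge {a} {b} qa≡qb y with y Fin.≟ b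
  ... | yes refl = qa≡qb
  ... | no _ = refl

  module _ (j₀ : Fin n) where

    blockColour : ℤ → Fin d
    blockColour i = q (ψ i j₀)

    -- Merging the q-equivalent colours of the two vertices yields a perfect
    -- colouring in which they have the same colour, hence the same neighbour
    -- counts: every colour next to one of them occurs next to the other.
    neighbour-colours-shared : ∀ {i i' δ} → blockColour i ≡ blockColour i' → UnitStep δ →
      OneOf (blockColour (i ℤ.+ δ)) (blockColour (i' ℤ.- 1ℤ)) (blockColour (i' ℤ.+ 1ℤ))
    neighbour-colours-shared {i} {i'} {δ} eq uδ with Equivalence.to (q-equiv (ψ i j₀) (ψ i' j₀)) eq
    ... | M , perfect′ =
      located (positive-sum _ _ (subst (0 <_) sameCounts (nbrCount-positive merged uδ i j₀)))
      where
      merged : Coloring n c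
      merged σ j = merge (ψ i j₀) (ψ i' j₀) (ψ σ j)
      β : Fin c
      β = merged (i ℤ.+ δ) j₀
      sameColour : merged i j₀ ≡ merged i' j₀
      sameColour = trans (merge-self {a = ψ i j₀} {b = ψ i' j₀}) (sym (merge-≡ {a = ψ i j₀} {b = ψ i' j₀} refl))
      sameCounts : nbrCount merged i β ≡ nbrCount merged i' β
      sameCounts = trans (perfect′ i j₀ β) (trans (cong (λ y → M y β) sameColour) (sym (perfect′ i' j₀ β)))
      colourOf : ∀ σ j → merged σ j ≡ β → blockColour (i ℤ.+ δ) ≡ blockColour σ
      colourOf σ j merged≡β =
        trans (sym (q-merge eq (ψ (i ℤ.+ δ) j₀)))
              (trans (cong q (sym merged≡β)) (trans (q-merge eq (ψ σ j)) (reduced-blockwise σ j j₀)))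
      located : 0 < countBlock (merged (i' ℤ.- 1ℤ)) β ⊎ 0 < countBlock (merged (i' ℤ.+ 1ℤ)) β →
        OneOf (blockColour (i ℤ.+ δ)) (blockColour (i' ℤ.- 1ℤ)) (blockColour (i' ℤ.+ 1ℤ))
      located (inj₁ pos) = let j , e = countBlock-witness _ β pos in inj₁ (colourOf _ j e)
      located (inj₂ pos) = let j , e = countBlock-witness _ β pos in inj₂ (colourOf _ j e)

    blockColour-locallySymmetric : LocallySymmetric blockColour
    blockColour-locallySymmetric i i' eq =
      oneOf⇒samePair (neighbour-colours-shared eq (inj₂ refl)) (neighbour-colours-shared eq (inj₁ refl))
                     (neighbour-colours-shared (sym eq) (inj₂ refl)) (neighbour-colours-shared (sym eq) (inj₁ refl))

lemma6 : (n : ℕ) (n≥1 : 1 ≤ n) (d : ℕ) (φ : Coloring n d) → Reduced φ →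
    (ε : Fin 2) →
    Σ ℕ λ k → 1 ≤ k × Σ (List ℕ) λ P →
      (P ≡ S11 k ⊎ P ≡ S12 k ⊎ P ≡ S22 k ⊎ P ≡ Scyc k) ×
      Σ ℤ λ t → Σ (ℕ → Fin d) λ r →
        ((a b : ℕ) → a < k → b < k → r a ≡ r b → a ≡ b) ×
        ((m : ℤ) → φ (+ 2 ℤ.* (m ℤ.+ t) ℤ.+ + toℕ ε) (fromℕ< n≥1) ≡ r (at P m))
lemma6 n n≥1 d φ (c , ψ , _ , perfect , q , q-equiv , φ≡qψ) ε =
  translateOrReflect⇒followsPattern
    (translateOrReflect-affine (locallySymmetric⇒translateOrReflect locSym) (+ 2) (+ toℕ ε))
  where
  open Reduction perfect q q-equiv
  j₀ : Fin n
  j₀ = fromℕ< n≥1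
  locSym : LocallySymmetric (λ i → φ i j₀)
  locSym = locallySymmetric-≗ (λ i → sym (φ≡qψ i j₀)) (blockColour-locallySymmetric j₀)
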